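{- There is a constant $k$ and a (non-uniform) family of constant-depth, polynomial-size circuits with unbounded fan-in AND, OR, NOT gates which, for every $x\in\{0,1\}^*$, on input $x$ outputs a linear arrangement (linear ordering of the vertices) of the graph $G_x$ defined below whose cutwidth is at most $k$.
   Context: The cutwidth of a linear arrangement of a graph is the maximum, over all gaps between consecutive vertices, of the number of edges joining a vertex before the gap to a vertex after it. Construction of $G_x$. For $x=x_1\cdots x_n$ let $f(x)=0\,\mathrm{bd}(0x_10x_20\cdots0x_n0)\,0$, where $\mathrm{bd}(y_1\cdots y_k)=y_1y_1\cdots y_ky_k$. Write $f(x)=y_1\cdots y_m$ ($m$ even) and split it into constituent pairs $P_k=y_{2k-1}y_{2k}$, $k=1,\dots,m/2$; each $P_k\in\{00,01,10\}$. Three blocks are defined, each drawn in a $2\times6$ piece of the integer lattice with local columns $0,1$ and rows $0,\dots,5$: - $G_{00}$: vertices $(0,0),(1,0),(0,5),(1,5),(0,2),(0,3)$; edges $(0,0)(1,0)$, $(0,5)(1,5)$, $(0,2)(0,3)$. - $G_{01}$: vertices $(0,1),(1,1),(0,4),(1,4),(1,2),(1,3)$; edges $(0,1)(1,1)$, $(0,4)(1,4)$, $(1,2)(1,3)$. - $G_{10}$: vertices $(0,0),(1,0),(0,5),(1,5),(0,1),(0,4)$; edges $(0,0)(1,0)$, $(0,0)(0,1)$, $(0,5)(1,5)$, $(0,5)(0,4)$. $G_x$ is obtained by placing a copy of block $G_{P_k}$ in global columns $2k-2,2k-1$, and for each $k<m/2$ adding the two edges $(2k-1,a_k)(2k,b_{k+1})$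 and $(2k-1,5-a_k)(2k,5-b_{k+1})$, where $a_k=1$ if $P_k=01$ and $0$ otherwise, and $b_{k+1}=1$ if $P_{k+1}\in\{01,10\}$ and $0$ if $P_{k+1}=00$. -}

module Defs where

open import Data.Bool using (Bool; true; false; _∧_; _∨_; if_then_else_)
open import Data.Nat using (ℕ; zero; suc; _+_; _*_; _∸_; _≤ᵇ_; _<ᵇ_; _≡ᵇ_; _⊔_)
open import Data.Fin using (Fin; toℕ)
open import Data.Bool.ListAction using (any)
open import Data.List using (List; []; _∷_; _++_; map; concatMap; length; filterᵇ; allFin; foldr)
open import Data.Vec using (Vec; lookup)
open import Data.Product using (_×_; _,_; ∃-syntax; Σ-syntax)
open import Data.List.Membership.Propositional using (_∈_)
open import Relation.Binary.PropositionalEquality using (_≡_)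

bd : List Bool → List Bool
bd [] = []
bd (y ∷ ys) = y ∷ y ∷ bd ys

interleave0 : List Bool → List Bool
interleave0 x = false ∷ concatMap (λ b → b ∷ false ∷ []) x

f : List Bool → List Bool
f x = false ∷ (bd (interleave0 x) ++ (false ∷ []))

-- constituent pairs P_1, P_2, … (true = 1, false = 0)
pairs : List Bool → List (Bool × Bool)
pairs (a ∷ b ∷ r) = (a , b) ∷ pairs r
pairs _ = []

-- The graph G_x, with vertices lattice points (column , row)

Pt : Set
Pt = ℕ × ℕ

record Graph : Set where
  field
    V : List Pt
    E : List (Pt × Pt)
open Graph public

-- local blocks (the pair 11 never occurs; it gets the empty block)
blockV : Bool × Bool → List Pt
blockV (false , false) = (0 , 0) ∷ (1 , 0) ∷ (0 , 5) ∷ (1 , 5) ∷ (0 , 2) ∷ (0 , 3) ∷ []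
blockV (false , true)  = (0 , 1) ∷ (1 , 1) ∷ (0 , 4) ∷ (1 , 4) ∷ (1 , 2) ∷ (1 , 3) ∷ []
blockV (true , false)  = (0 , 0) ∷ (1 , 0) ∷ (0 , 5) ∷ (1 , 5) ∷ (0 , 1) ∷ (0 , 4) ∷ []
blockV (true , true)   = []

blockE : Bool × Bool → List (Pt × Pt)
blockE (false , false) = ((0 , 0) , (1 , 0)) ∷ ((0 , 5) , (1 , 5)) ∷ ((0 , 2) , (0 , 3)) ∷ []
blockE (false , true)  = ((0 , 1) , (1 , 1)) ∷ ((0 , 4) , (1 , 4)) ∷ ((1 , 2) , (1 , 3)) ∷ []
blockE (true , false)  = ((0 , 0) , (1 , 0)) ∷ ((0 , 0) , (0 , 1)) ∷ ((0 , 5) , (1 , 5)) ∷ ((0 , 5) , (0 , 4)) ∷ []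
blockE (true , true)   = []

aOf : Bool × Bool → ℕ
aOf (false , true) = 1
aOf _ = 0

bOf : Bool × Bool → ℕ
bOf (false , false) = 0
bOf _ = 1

shiftPt : ℕ → Pt → Pt
shiftPt s (c , r) = (s + c , r)

shiftE : ℕ → Pt × Pt → Pt × Pt
shiftE s (u , v) = (shiftPt s u , shiftPt s v)

-- block number j (0-indexed, i.e. j = k - 1) occupies global columns 2j, 2j+1
vertsFrom : ℕ → List (Bool × Bool) → List Pt
vertsFrom j [] = []
vertsFrom j (P ∷ Ps) = map (shiftPt (2 * j)) (blockV P) ++ vertsFrom (suc j) Ps

connect : ℕ → Bool × Bool → Bool × Bool → List (Pt × Pt)
connect j P Q =
  ((2 * j + 1 , aOf P) , (2 * j + 2 , bOf Q)) ∷
  ((2 * j + 1 , 5 ∸ aOf P) , (2 * j + 2 , 5 ∸ bOf Q)) ∷ []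

edgesFrom : ℕ → List (Bool × Bool) → List (Pt × Pt)
edgesFrom j [] = []
edgesFrom j (P ∷ []) = map (shiftE (2 * j)) (blockE P)
edgesFrom j (P ∷ Q ∷ Ps) =
  map (shiftE (2 * j)) (blockE P) ++ connect j P Q ++ edgesFrom (suc j) (Q ∷ Ps)

G : List Bool → Graph
G x = record { V = vertsFrom 0 (pairs (f x)) ; E = edgesFrom 0 (pairs (f x)) }

-- Linear arrangements (given as a 0/1 relation "vertex v is at position i")

IsLinearArrangement : (Γ : Graph) (N : ℕ) → (Fin N → Pt → Bool) → Set
IsLinearArrangement Γ N A =
  ((i : Fin N) → ∃[ v ] (A i v ≡ true × v ∈ V Γ × ((w : Pt) → A i w ≡ true → w ≡ v)))
  × ((v : Pt) → v ∈ V Γ → ∃[ i ] (A i v ≡ true × ((j : Fin N) → A j v ≡ true → j ≡ i)))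

before after : {N : ℕ} → (Fin N → Pt → Bool) → Fin N → Pt → Bool
before {N} A g v = any (λ i → (toℕ i ≤ᵇ toℕ g) ∧ A i v) (allFin N)
after  {N} A g v = any (λ i → (toℕ g <ᵇ toℕ i) ∧ A i v) (allFin N)

cut : {N : ℕ} → Graph → (Fin N → Pt → Bool) → Fin N → ℕ
cut Γ A g = length (filterᵇ (λ { (u , v) → (before A g u ∧ after A g v) ∨ (before A g v ∧ after A g u) }) (E Γ))

-- cutwidth = maximum over the gaps (the "gap" after the last position has cut 0)
cutwidth : {N : ℕ} → Graph → (Fin N → Pt → Bool) → ℕ
cutwidth {N} Γ A = foldr _⊔_ 0 (map (cut Γ A) (allFin N))

-- Boolean circuits with unbounded fan-in AND / OR and NOT gates
-- (represented as formulas)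

data Circuit (n : ℕ) : Set where
  input : Fin n → Circuit n
  not   : Circuit n → Circuit n
  and   : List (Circuit n) → Circuit n
  or    : List (Circuit n) → Circuit n

mutual
  eval : {n : ℕ} → Vec Bool n → Circuit n → Bool
  eval x (input i) = lookup x i
  eval x (not c) = if eval x c then false else true
  eval x (and cs) = evalAnd x cs
  eval x (or cs) = evalOr x cs

  evalAnd : {n : ℕ} → Vec Bool n → List (Circuit n) → Bool
  evalAnd x [] = true
  evalAnd x (c ∷ cs) = eval x c ∧ evalAnd x cs

  evalOr : {n : ℕ} → Vec Bool n → List (Circuit n) → Bool
  evalOr x [] = false
  evalOr x (c ∷ cs) = eval x c ∨ evalOr x cs

mutual
  depth : {n : ℕ} → Circuit n → ℕ
  depth (input i) = 0
  depth (not c) = suc (depth c)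
  depth (and cs) = suc (depthL cs)
  depth (or cs) = suc (depthL cs)

  depthL : {n : ℕ} → List (Circuit n) → ℕ
  depthL [] = 0
  depthL (c ∷ cs) = depth c ⊔ depthL cs

mutual
  size : {n : ℕ} → Circuit n → ℕ
  size (input i) = 1
  size (not c) = suc (size c)
  size (and cs) = suc (sizeL cs)
  size (or cs) = suc (sizeL cs)

  sizeL : {n : ℕ} → List (Circuit n) → ℕ
  sizeL [] = 0
  sizeL (c ∷ cs) = size c + sizeL cs

-- Output encoding: for input length n, G_x has 12n+12 vertices in the
-- columns 0 … 4n+3 and rows 0 … 5.  There is one output bit for each
-- (position i, column c, row r), meaning "vertex (c , r) is at position i".

numPos numCols : ℕ → ℕ
numPos n = 12 * n + 12
numCols n = 4 * n + 4

OutputFamily : Set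
OutputFamily = (n : ℕ) → Fin (numPos n) → Fin (numCols n) → Fin 6 → Circuit n

computed : (C : OutputFamily) {n : ℕ} → Vec Bool n → Fin (numPos n) → Pt → Bool
computed C {n} x i (c , r) =
  any (λ c' → any (λ r' → (toℕ c' ≡ᵇ c) ∧ (toℕ r' ≡ᵇ r) ∧ eval x (C n i c' r')) (allFin 6)) (allFin (numCols n))

module Submission where

-- Split f(x) into its pairs P_0 P_1 … P_{2n+1}: P_0 = 00, each input bit b contributes
-- 0b and b0, and the word ends with 00.  So every pair is 00, 01 or 10 and depends on at
-- most one input bit.  Position i = 6q + s of the arrangement carries the s-th vertex (in
-- the order of blockV) of block q.  The output bit "vertex (c , r) is at position i" is
-- therefore a Boolean function of a single input bit, computed by a circuit of depth 1.
--
-- Two general facts then give the theorem: a relation singling out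
-- one vertex per position, through a bijection onto V(G), is a linear arrangement; and a
-- sequence of numbers, each ≤ 6 and vanishing outside two consecutive indices, sums to at
-- most 12.  The latter bounds each cut: the gap after a position of block B separates
-- columns ≤ 2B+1 from columns ≥ 2B, while the edges of block q together with the two
-- edges joining it to block q+1 stay in columns 2q … 2q+2, so only the segments
-- q = B-1 and q = B, of at most 6 edges each, can cross the gap.

open import Defs
open import Data.Bool using (Bool; true; false; T; if_then_else_; _∧_; _∨_)
open import Data.Bool.Properties using (T-≡; T-∧; T-∨; if-float; if-eta)
open import Data.Bool.ListAction using (any)
open import Data.Nat using (ℕ; zero; suc; _≤_; _<_; _+_; _*_; _∸_; _^_; _/_; _%_; _≡ᵇ_; _≤?_; _<?_; z≤n; s≤s; _⊔_)
open import Data.Nat.Properties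
open import Data.Nat.DivMod using (m%n<n; m≡m%n+[m/n]*n; m<n*o⇒m/o<n; /-monoˡ-≤; +-distrib-/-∣ʳ; m<n⇒m/n≡0; m*n/n≡m; [m+kn]%n≡m%n; m<n⇒m%n≡m)
open import Data.Nat.Divisibility using (divides-refl)
open import Data.Nat.ListAction using (sum)
open import Data.Nat.Tactic.RingSolver using (solve-∀)
open import Data.Fin using (Fin; toℕ; fromℕ<) renaming (zero to fzero; suc to fsuc)
open import Data.Fin.Properties using (toℕ-fromℕ<; toℕ-injective; toℕ<n; all?) renaming (_≟_ to _≟ᶠ_)
open import Data.List using (List; []; _∷_; _++_; map; concat; concatMap; length; allFin; filterᵇ; foldr)
open import Data.List.Properties using (filter-++; length-++; length-filter; length-map; filter-none; map-++; ++-assoc; ++-identityʳ)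
open import Data.List.Relation.Unary.All using (All; []; _∷_) renaming (map to mapAll; all? to allᴸ?)
open import Data.List.Relation.Unary.All.Properties using (++⁺; map⁺)
open import Data.List.Relation.Unary.Any using (satisfied)
open import Data.List.Relation.Unary.Any.Properties using (any⁺; any⁻)
open import Data.List.Membership.Propositional using (_∈_; lose)
open import Data.List.Membership.Propositional.Properties using (∈-map⁺; ∈-map⁻; ∈-++⁺ˡ; ∈-++⁺ʳ; ∈-++⁻; ∈-allFin)
open import Data.Vec using (Vec; toList; lookup) renaming ([] to []ᵛ; _∷_ to _∷ᵛ_)
open import Data.Vec.Properties using (length-toList)
open import Data.Product using (_×_; _,_; proj₁; proj₂; ∃-syntax; Σ-syntax)
open import Data.Product.Properties using (≡-dec)
open import Data.Sum using (_⊎_; inj₁; inj₂)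
open import Data.Empty using (⊥-elim)
open import Function using (_∘_; Equivalence)
open import Relation.Nullary using (¬_; Dec; yes; no)
open import Relation.Nullary.Decidable using (True; ⌊_⌋; toWitness; fromWitness; T?; _×-dec_; _→-dec_)
open import Relation.Binary.PropositionalEquality using (_≡_; _≢_; refl; sym; trans; cong; cong₂; subst; module ≡-Reasoning)

open Equivalence using (to; from)

nth : {A : Set} → A → List A → ℕ → A
nth d [] k = d
nth d (a ∷ as) zero = a
nth d (a ∷ as) (suc k) = nth d as k

nth-All : {A : Set} {P : A → Set} {d : A} → P d → ∀ {as} → All P as → ∀ k → P (nth d as k)
nth-All Pd [] k = Pd
nth-All Pd (Pa ∷ Pas) zero = Pa
nth-All Pd (Pa ∷ Pas) (suc k) = nth-All Pd Pas k

half-≤ : ∀ {a b} → 2 * a ≤ suc (2 * b) → a ≤ b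
half-≤ {a} {b} h = ≤-pred (*-cancelˡ-< 2 a (suc b) (subst (suc (2 * a) ≤_) (sym (*-suc 2 b)) (s≤s h)))

Pair : Set
Pair = Bool × Bool

-- The pair 11 never occurs in f(x) (blockV gives it no vertices).
Real : Pair → Set
Real P = P ≢ (true , true)

inputPairs : List Bool → List Pair
inputPairs [] = (false , false) ∷ []
inputPairs (b ∷ bs) = (false , b) ∷ (b , false) ∷ inputPairs bs

pairs-f : ∀ bs → pairs (f bs) ≡ (false , false) ∷ inputPairs bs
pairs-f bs = cong ((false , false) ∷_) (pairs-tail bs)
  where
  pairs-tail : ∀ bs → pairs (false ∷ (bd (concatMap (λ b → b ∷ false ∷ []) bs) ++ false ∷ [])) ≡ inputPairs bs
  pairs-tail [] = refl
  pairs-tail (b ∷ bs) = cong (λ Ps → (false , b) ∷ (b , false) ∷ Ps) (pairs-tail bs)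

length-inputPairs : ∀ bs → length (inputPairs bs) ≡ suc (length bs + length bs)
length-inputPairs [] = refl
length-inputPairs (b ∷ bs) = cong (suc ∘ suc) (trans (length-inputPairs bs) (sym (+-suc (length bs) (length bs))))

numBlocks : ℕ → ℕ
numBlocks n = suc (suc (n + n))

numPos-blocks : ∀ n → numPos n ≡ numBlocks n * 6
numPos-blocks = identity
  where
  identity : ∀ n → 12 * n + 12 ≡ suc (suc (n + n)) * 6
  identity = solve-∀

numCols-blocks : ∀ n → numCols n ≡ 2 * numBlocks n
numCols-blocks = identity
  where
  identity : ∀ n → 4 * n + 4 ≡ 2 * suc (suc (n + n))
  identity = solve-∀

-- The q-th pair of a pair list (00 past its end, where no block is read).
pairIn : List Pair → ℕ → Pair
pairIn = nth (false , false)

pairSeq : {n : ℕ} → Vec Bool n → List Pair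
pairSeq x = pairs (f (toList x))

pairAt : {n : ℕ} → Vec Bool n → ℕ → Pair
pairAt x = pairIn (pairSeq x)

length-pairSeq : ∀ {n} (x : Vec Bool n) → length (pairSeq x) ≡ numBlocks n
length-pairSeq {n} x = begin
  length (pairSeq x)                                         ≡⟨ cong length (pairs-f (toList x)) ⟩
  suc (length (inputPairs (toList x)))                       ≡⟨ cong suc (length-inputPairs (toList x)) ⟩
  suc (suc (length (toList x) + length (toList x)))          ≡⟨ cong (λ m → suc (suc (m + m))) (length-toList x) ⟩
  numBlocks n                                                ∎
  where open ≡-Reasoning

pairAt-real : ∀ {n} (x : Vec Bool n) q → Real (pairAt x q)
pairAt-real x = nth-All (λ ()) (subst (All Real) (sym (pairs-f (toList x))) ((λ ()) ∷ inputPairs-real (toList x)))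
  where
  inputPairs-real : ∀ bs → All Real (inputPairs bs)
  inputPairs-real [] = (λ ()) ∷ []
  inputPairs-real (b ∷ bs) = (λ ()) ∷ (λ ()) ∷ inputPairs-real bs

slot : Pair → Fin 6 → Pt
slot P s = nth (0 , 0) (blockV P) (toℕ s)

blockV-slots : ∀ P → Real P → blockV P ≡ map (slot P) (allFin 6)
blockV-slots (false , false) _ = refl
blockV-slots (false , true) _ = refl
blockV-slots (true , false) _ = refl
blockV-slots (true , true) real = ⊥-elim (real refl)

slot-∈ : ∀ P s → Real P → slot P s ∈ blockV P
slot-∈ P s real = subst (slot P s ∈_) (sym (blockV-slots P real)) (∈-map⁺ (slot P) (∈-allFin s))

blockV-real : ∀ P {p} → p ∈ blockV P → Real P
blockV-real (false , _) _ = λ ()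
blockV-real (true , false) _ = λ ()
blockV-real (true , true) ()

∈-slot : ∀ P {p} → p ∈ blockV P → ∃[ s ] p ≡ slot P s
∈-slot P {p} p∈ with s , _ , p≡ ← ∈-map⁻ (slot P) (subst (p ∈_) (blockV-slots P (blockV-real P p∈)) p∈) = s , p≡

_≟ᵖ_ : (p q : Pt) → Dec (p ≡ q)
_≟ᵖ_ = ≡-dec _≟_ _≟_

_≡ᵖ_ : Pt → Pt → Bool
p ≡ᵖ q = ⌊ p ≟ᵖ q ⌋

slot-local : ∀ P s → proj₁ (slot P s) ≤ 1 × proj₂ (slot P s) < 6
slot-local P = toWitness {a? = local? P} (check P)
  where
  local? : ∀ P → Dec (∀ s → proj₁ (slot P s) ≤ 1 × proj₂ (slot P s) < 6)
  local? P = all? λ s → (proj₁ (slot P s) ≤? 1) ×-dec (proj₂ (slot P s) <? 6)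
  check : ∀ P → True (local? P)
  check (false , false) = _
  check (false , true) = _
  check (true , false) = _
  check (true , true) = _

slot-injective : ∀ P → Real P → ∀ s s' → slot P s ≡ slot P s' → s ≡ s'
slot-injective P real = toWitness {a? = injective? P} (check P real)
  where
  injective? : ∀ P → Dec (∀ s s' → slot P s ≡ slot P s' → s ≡ s')
  injective? P = all? λ s → all? λ s' → (slot P s ≟ᵖ slot P s') →-dec (s ≟ᶠ s')
  check : ∀ P → Real P → True (injective? P)
  check (false , false) _ = _
  check (false , true) _ = _
  check (true , false) _ = _
  check (true , true) real = ⊥-elim (real refl)

place : ℕ → Pair → Fin 6 → Pt
place q P s = shiftPt (2 * q) (slot P s)

place-col : ∀ q P s → 2 * q ≤ proj₁ (place q P s) × proj₁ (place q P s) ≤ suc (2 * q)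
place-col q P s =
  m≤m+n (2 * q) _ ,
  ≤-trans (+-monoʳ-≤ (2 * q) (proj₁ (slot-local P s))) (≤-reflexive (+-comm (2 * q) 1))

place-block-injective : ∀ q q' P P' s s' → place q P s ≡ place q' P' s' → q ≡ q'
place-block-injective q q' P P' s s' e = ≤-antisym (below q q' P P' s s' e) (below q' q P' P s' s (sym e))
  where
  below : ∀ q q' P P' s s' → place q P s ≡ place q' P' s' → q ≤ q'
  below q q' P P' s s' e =
    half-≤ (≤-trans (proj₁ (place-col q P s)) (subst (_≤ suc (2 * q')) (sym (cong proj₁ e)) (proj₂ (place-col q' P' s'))))

place-slot-injective : ∀ q P s s' → place q P s ≡ place q P s' → slot P s ≡ slot P s'
place-slot-injective q P s s' e = cong₂ _,_ (+-cancelˡ-≡ (2 * q) _ _ (cong proj₁ e)) (cong proj₂ e)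

place-∈ : ∀ j Ps k s → k < length Ps → Real (pairIn Ps k) → place (j + k) (pairIn Ps k) s ∈ vertsFrom j Ps
place-∈ j (P ∷ Ps) zero s _ real =
  subst (λ t → place t P s ∈ vertsFrom j (P ∷ Ps)) (sym (+-identityʳ j))
        (∈-++⁺ˡ (∈-map⁺ (shiftPt (2 * j)) (slot-∈ P s real)))
place-∈ j (P ∷ Ps) (suc k) s (s≤s k<) real =
  subst (λ t → place t (pairIn Ps k) s ∈ vertsFrom j (P ∷ Ps)) (sym (+-suc j k))
        (∈-++⁺ʳ (map (shiftPt (2 * j)) (blockV P)) (place-∈ (suc j) Ps k s k< real))

∈-place : ∀ j Ps {v} → v ∈ vertsFrom j Ps → ∃[ k ] k < length Ps × ∃[ s ] v ≡ place (j + k) (pairIn Ps k) s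
∈-place j (P ∷ Ps) v∈ with ∈-++⁻ (map (shiftPt (2 * j)) (blockV P)) v∈
... | inj₁ v∈P
  with p , p∈ , v≡ ← ∈-map⁻ (shiftPt (2 * j)) v∈P
  with s , p≡ ← ∈-slot P p∈ =
  0 , s≤s z≤n , s , trans v≡ (cong₂ (λ t p → shiftPt (2 * t) p) (sym (+-identityʳ j)) p≡)
... | inj₂ v∈Ps
  with k , k< , s , v≡ ← ∈-place (suc j) Ps v∈Ps =
  suc k , s≤s k< , s , trans v≡ (cong (λ t → place t (pairIn Ps k) s) (sym (+-suc j k)))

blockOf : ℕ → ℕ
blockOf i = i / 6

slotOf : ℕ → Fin 6
slotOf i = fromℕ< (m%n<n i 6)

position-split : ∀ i → i ≡ toℕ (slotOf i) + blockOf i * 6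
position-split i = trans (m≡m%n+[m/n]*n i 6) (cong (_+ blockOf i * 6) (sym (toℕ-fromℕ< (m%n<n i 6))))

position-of : ∀ q (s : Fin 6) → blockOf (toℕ s + q * 6) ≡ q × slotOf (toℕ s + q * 6) ≡ s
position-of q s = block , toℕ-injective (trans (toℕ-fromℕ< (m%n<n (toℕ s + q * 6) 6)) remainder)
  where
  open ≡-Reasoning
  block : (toℕ s + q * 6) / 6 ≡ q
  block = begin
    (toℕ s + q * 6) / 6     ≡⟨ +-distrib-/-∣ʳ (toℕ s) (divides-refl q) ⟩
    toℕ s / 6 + q * 6 / 6   ≡⟨ cong₂ _+_ (m<n⇒m/n≡0 (toℕ<n s)) (m*n/n≡m q 6) ⟩
    q                       ∎
  remainder : (toℕ s + q * 6) % 6 ≡ toℕ s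
  remainder = trans ([m+kn]%n≡m%n (toℕ s) q 6) (m<n⇒m%n≡m (toℕ<n s))

position< : ∀ {q m} (s : Fin 6) → q < m → toℕ s + q * 6 < m * 6
position< {q} s q<m = ≤-trans (+-monoˡ-< (q * 6) (toℕ<n s)) (*-monoˡ-≤ 6 q<m)

vert : {n : ℕ} → Vec Bool n → ℕ → Pt
vert x i = place (blockOf i) (pairAt x (blockOf i)) (slotOf i)

vert-injective : ∀ {n} (x : Vec Bool n) {i i'} → vert x i ≡ vert x i' → i ≡ i'
vert-injective x {i} {i'} e = begin
  i                                  ≡⟨ position-split i ⟩
  toℕ (slotOf i) + blockOf i * 6     ≡⟨ cong₂ (λ s q → toℕ s + q * 6) same-slot same-block ⟩
  toℕ (slotOf i') + blockOf i' * 6   ≡⟨ position-split i' ⟨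
  i'                                 ∎
  where
  open ≡-Reasoning
  same-block : blockOf i ≡ blockOf i'
  same-block = place-block-injective _ _ (pairAt x (blockOf i)) (pairAt x (blockOf i')) (slotOf i) (slotOf i') e
  same-slot : slotOf i ≡ slotOf i'
  same-slot = slot-injective _ (pairAt-real x (blockOf i)) _ _
    (place-slot-injective (blockOf i) (pairAt x (blockOf i)) (slotOf i) (slotOf i')
      (trans e (cong (λ q → place q (pairAt x q) (slotOf i')) (sym same-block))))

block< : ∀ n {i} → i < numPos n → blockOf i < numBlocks n
block< n {i} i< = m<n*o⇒m/o<n {i} (subst (i <_) (numPos-blocks n) i<)

vert-∈ : ∀ {n} (x : Vec Bool n) {i} → i < numPos n → vert x i ∈ V (G (toList x))
vert-∈ {n} x {i} i< =
  place-∈ 0 (pairSeq x) (blockOf i) (slotOf i)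
          (subst (blockOf i <_) (sym (length-pairSeq x)) (block< n i<)) (pairAt-real x (blockOf i))

vert-onto : ∀ {n} (x : Vec Bool n) {v} → v ∈ V (G (toList x)) → ∃[ i ] i < numPos n × vert x i ≡ v
vert-onto {n} x v∈ with ∈-place 0 (pairSeq x) v∈
... | q , q< , s , v≡ = toℕ s + q * 6 , bound , trans at-i (sym v≡)
  where
  bound : toℕ s + q * 6 < numPos n
  bound = subst (toℕ s + q * 6 <_) (sym (numPos-blocks n)) (position< s (subst (q <_) (length-pairSeq x) q<))
  at-i : vert x (toℕ s + q * 6) ≡ place q (pairAt x q) s
  at-i = cong₂ (λ q s → place q (pairAt x q) s) (proj₁ (position-of q s)) (proj₂ (position-of q s))

vert-grid : ∀ {n} (x : Vec Bool n) {i} → i < numPos n → proj₁ (vert x i) < numCols n × proj₂ (vert x i) < 6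
vert-grid {n} x {i} i< =
  subst (proj₁ (vert x i) <_) (sym (numCols-blocks n))
        (≤-trans (s≤s (proj₂ (place-col q P s))) (subst (_≤ 2 * numBlocks n) (*-suc 2 q) (*-monoʳ-≤ 2 (block< n i<)))) ,
  proj₂ (slot-local P s)
  where
  q : ℕ
  q = blockOf i
  P : Pair
  P = pairAt x q
  s : Fin 6
  s = slotOf i

-- A value of type A determined by at most one input bit: `bit m a₁ a₀` is a₁ if x_m
-- holds and a₀ otherwise.
data OneBit (A : Set) (n : ℕ) : Set where
  const : A → OneBit A n
  bit   : Fin n → A → A → OneBit A n

⟦_⟧ : {A : Set} {n : ℕ} → OneBit A n → Vec Bool n → A
⟦ const a ⟧ x = a
⟦ bit m a₁ a₀ ⟧ x = if lookup x m then a₁ else a₀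

mapOB : {A B : Set} {n : ℕ} → (A → B) → OneBit A n → OneBit B n
mapOB g (const a) = const (g a)
mapOB g (bit m a₁ a₀) = bit m (g a₁) (g a₀)

⟦⟧-map : {A B : Set} {n : ℕ} (g : A → B) (d : OneBit A n) (x : Vec Bool n) → ⟦ mapOB g d ⟧ x ≡ g (⟦ d ⟧ x)
⟦⟧-map g (const a) x = refl
⟦⟧-map g (bit m a₁ a₀) x = sym (if-float g (lookup x m))

weaken : {A : Set} {n : ℕ} → OneBit A n → OneBit A (suc n)
weaken (const a) = const a
weaken (bit m a₁ a₀) = bit (fsuc m) a₁ a₀

⟦⟧-weaken : {A : Set} {n : ℕ} (d : OneBit A n) (b : Bool) (x : Vec Bool n) → ⟦ weaken d ⟧ (b ∷ᵛ x) ≡ ⟦ d ⟧ x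
⟦⟧-weaken (const a) b x = refl
⟦⟧-weaken (bit m a₁ a₀) b x = refl

pairDesc : (n q : ℕ) → OneBit Pair n
pairDesc n zero = const (false , false)
pairDesc n (suc q) = inputPairDesc n q
  where
  inputPairDesc : (n q : ℕ) → OneBit Pair n
  inputPairDesc zero q = const (false , false)
  inputPairDesc (suc n) zero = bit fzero (false , true) (false , false)
  inputPairDesc (suc n) (suc zero) = bit fzero (true , false) (false , false)
  inputPairDesc (suc n) (suc (suc q)) = weaken (inputPairDesc n q)

pairAt-desc : ∀ {n} (x : Vec Bool n) q → pairAt x q ≡ ⟦ pairDesc n q ⟧ x
pairAt-desc x q = trans (cong (λ Ps → pairIn Ps q) (pairs-f (toList x))) (leading q)
  where
  inputs : ∀ {n} (x : Vec Bool n) q → pairIn (inputPairs (toList x)) q ≡ ⟦ pairDesc n (suc q) ⟧ x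
  inputs []ᵛ zero = refl
  inputs []ᵛ (suc q) = refl
  inputs (false ∷ᵛ x) zero = refl
  inputs (true ∷ᵛ x) zero = refl
  inputs (false ∷ᵛ x) (suc zero) = refl
  inputs (true ∷ᵛ x) (suc zero) = refl
  inputs {suc n} (b ∷ᵛ x) (suc (suc q)) = trans (inputs x q) (sym (⟦⟧-weaken (pairDesc n (suc q)) b x))
  leading : ∀ q → pairIn ((false , false) ∷ inputPairs (toList x)) q ≡ ⟦ pairDesc _ q ⟧ x
  leading zero = refl
  leading (suc q) = inputs x q

compile : {n : ℕ} → OneBit Bool n → Circuit n
compile (const true) = and []
compile (const false) = or []
compile (bit m true true) = and []
compile (bit m true false) = input m
compile (bit m false true) = not (input m)
compile (bit m false false) = or []

compile-correct : ∀ {n} (x : Vec Bool n) d → eval x (compile d) ≡ ⟦ d ⟧ x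
compile-correct x (const true) = refl
compile-correct x (const false) = refl
compile-correct x (bit m true true) = sym (if-eta (lookup x m))
compile-correct x (bit m true false) with lookup x m
... | true = refl
... | false = refl
compile-correct x (bit m false true) with lookup x m
... | true = refl
... | false = refl
compile-correct x (bit m false false) = sym (if-eta (lookup x m))

compile-shallow : ∀ {n} (d : OneBit Bool n) → depth (compile d) ≤ 1 × size (compile d) ≤ 2
compile-shallow (const true) = s≤s z≤n , s≤s z≤n
compile-shallow (const false) = s≤s z≤n , s≤s z≤n
compile-shallow (bit m true true) = s≤s z≤n , s≤s z≤n
compile-shallow (bit m true false) = z≤n , s≤s z≤n
compile-shallow (bit m false true) = s≤s z≤n , s≤s (s≤s z≤n)
compile-shallow (bit m false false) = s≤s z≤n , s≤s z≤n

-- Output bit (i , c , r) asks whether (c , r) is the vertex at position i; the block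
-- of position i carries a pair depending on one input bit, so one bit suffices.
arrangementCircuits : OutputFamily
arrangementCircuits n i c r =
  compile (mapOB (λ P → (toℕ c , toℕ r) ≡ᵖ place q P (slotOf (toℕ i))) (pairDesc n q))
  where
  q : ℕ
  q = blockOf (toℕ i)

arrangementCircuits-shallow : ∀ n i c r → depth (arrangementCircuits n i c r) ≤ 1 × size (arrangementCircuits n i c r) ≤ 2
arrangementCircuits-shallow n i c r = compile-shallow (mapOB _ (pairDesc n (blockOf (toℕ i))))

arrangementCircuits-test : ∀ {n} (x : Vec Bool n) i c r →
  eval x (arrangementCircuits n i c r) ≡ ((toℕ c , toℕ r) ≡ᵖ vert x (toℕ i))
arrangementCircuits-test {n} x i c r = begin
  eval x (arrangementCircuits n i c r)            ≡⟨ compile-correct x (mapOB test (pairDesc n q)) ⟩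
  ⟦ mapOB test (pairDesc n q) ⟧ x                 ≡⟨ ⟦⟧-map test (pairDesc n q) x ⟩
  test (⟦ pairDesc n q ⟧ x)                       ≡⟨ cong test (pairAt-desc x q) ⟨
  (toℕ c , toℕ r) ≡ᵖ vert x (toℕ i)               ∎
  where
  open ≡-Reasoning
  q : ℕ
  q = blockOf (toℕ i)
  test : Pair → Bool
  test P = (toℕ c , toℕ r) ≡ᵖ place q P (slotOf (toℕ i))

module PointTests {n : ℕ} (C : OutputFamily) (x : Vec Bool n) (v : Fin (numPos n) → Pt)
                  (tests : ∀ i c r → eval x (C n i c r) ≡ ((toℕ c , toℕ r) ≡ᵖ v i)) where

  cellTest : Fin (numPos n) → ℕ → ℕ → Fin (numCols n) → Fin 6 → Bool
  cellTest i c r c' r' = (toℕ c' ≡ᵇ c) ∧ (toℕ r' ≡ᵇ r) ∧ eval x (C n i c' r')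

  computed-only : ∀ i w → computed C x i w ≡ true → w ≡ v i
  computed-only i (c , r) holds
    with c' , hit ← satisfied (any⁻ (λ c' → any (cellTest i c r c') (allFin 6)) (allFin (numCols n)) (from T-≡ holds))
    with r' , hit' ← satisfied (any⁻ (cellTest i c r c') (allFin 6) hit)
    with c≡ , rest ← to T-∧ hit'
    with r≡ , test ← to T-∧ rest =
    trans (sym (cong₂ _,_ (≡ᵇ⇒≡ _ _ c≡) (≡ᵇ⇒≡ _ _ r≡)))
          (toWitness (subst T (tests i c' r') test))

  computed-hit : ∀ i → proj₁ (v i) < numCols n → proj₂ (v i) < 6 → computed C x i (v i) ≡ true
  computed-hit i c< r< =
    to T-≡ (any⁺ (λ c' → any (cellTest i c r c') (allFin 6)) (lose (∈-allFin c')
      (any⁺ (cellTest i c r c') (lose (∈-allFin r')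
        (from T-∧ (≡⇒≡ᵇ _ _ (toℕ-fromℕ< c<) , from T-∧ (≡⇒≡ᵇ _ _ (toℕ-fromℕ< r<) , test)))))))
    where
    c r : ℕ
    c = proj₁ (v i)
    r = proj₂ (v i)
    c' : Fin (numCols n)
    c' = fromℕ< c<
    r' : Fin 6
    r' = fromℕ< r<
    test : T (eval x (C n i c' r'))
    test = subst T (sym (tests i c' r'))
                 (fromWitness (cong₂ _,_ (toℕ-fromℕ< c<) (toℕ-fromℕ< r<)))

bijection-arrangement : ∀ (Γ : Graph) {N} (A : Fin N → Pt → Bool) (v : Fin N → Pt) →
  (∀ i w → A i w ≡ true → w ≡ v i) → (∀ i → A i (v i) ≡ true) →
  (∀ {i j} → v i ≡ v j → i ≡ j) → (∀ i → v i ∈ V Γ) → (∀ w → w ∈ V Γ → ∃[ i ] v i ≡ w) →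
  IsLinearArrangement Γ N A
bijection-arrangement Γ A v only hit injective into onto = positions , vertices
  where
  positions : (i : Fin _) → ∃[ w ] (A i w ≡ true × w ∈ V Γ × (∀ u → A i u ≡ true → u ≡ w))
  positions i = v i , hit i , into i , only i
  vertices : ∀ w → w ∈ V Γ → ∃[ i ] (A i w ≡ true × (∀ j → A j w ≡ true → j ≡ i))
  vertices w w∈ with i , vi≡w ← onto w w∈ =
    i , subst (λ u → A i u ≡ true) vi≡w (hit i) ,
    λ j Aj → injective (trans (sym (only j w Aj)) (sym vi≡w))

count : {A : Set} → (A → Bool) → List A → ℕ
count p xs = length (filterᵇ p xs)

count-concat : {A : Set} (p : A → Bool) (xss : List (List A)) → count p (concat xss) ≡ sum (map (count p) xss)
count-concat p [] = refl
count-concat p (xs ∷ xss) =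
  trans (cong length (filter-++ (T? ∘ p) xs (concat xss)))
        (trans (length-++ (filterᵇ p xs)) (cong (count p xs +_) (count-concat p xss)))

data Window (B : ℕ) : ℕ → List ℕ → Set where
  []      : ∀ {j} → Window B j []
  inside  : ∀ {j c cs} → j ≤ B → B ≤ suc j → c ≤ 6 → Window B (suc j) cs → Window B j (c ∷ cs)
  outside : ∀ {j cs} → Window B (suc j) cs → Window B j (0 ∷ cs)

window-past : ∀ {B j cs} → B < j → Window B j cs → sum cs ≡ 0
window-past B<j [] = refl
window-past B<j (inside j≤B _ _ _) = ⊥-elim (<⇒≱ B<j j≤B)
window-past B<j (outside rest) = window-past (m<n⇒m<1+n B<j) rest

window-last : ∀ {B cs} → Window B B cs → sum cs ≤ 6
window-last [] = z≤n
window-last {B} (inside {c = c} _ _ c≤6 rest) =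
  subst (_≤ 6) (sym (trans (cong (c +_) (window-past (n<1+n B) rest)) (+-identityʳ c))) c≤6
window-last {B} (outside rest) = ≤-trans (≤-reflexive (window-past (n<1+n B) rest)) z≤n

window-sum : ∀ {B j cs} → Window B j cs → sum cs ≤ 12
window-sum [] = z≤n
window-sum (outside rest) = window-sum rest
window-sum {B} w@(inside {j} {c} {cs} j≤B B≤1+j c≤6 rest) with m≤n⇒m<n∨m≡n j≤B
... | inj₁ j<B = +-mono-≤ c≤6 (window-last (subst (λ t → Window B t cs) (≤-antisym j<B B≤1+j) rest))
... | inj₂ refl = ≤-trans (window-last w) (m≤m+n 6 6)

col : Pt → ℕ
col = proj₁

InStrip : ℕ → Pt × Pt → Set
InStrip j (u , v) = (2 * j ≤ col u × col u ≤ 2 * suc j) × (2 * j ≤ col v × col v ≤ 2 * suc j)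

Crossing : ℕ → Pt × Pt → Set
Crossing B (u , v) = (col u ≤ suc (2 * B) × 2 * B ≤ col v) ⊎ (col v ≤ suc (2 * B) × 2 * B ≤ col u)

strip-crossing : ∀ {j B} e → InStrip j e → Crossing B e → j ≤ B × B ≤ suc j
strip-crossing (u , v) ((u₀ , u₁) , (v₀ , v₁)) (inj₁ (u≤ , ≤v)) =
  half-≤ (≤-trans u₀ u≤) , *-cancelˡ-≤ 2 (≤-trans ≤v v₁)
strip-crossing (u , v) ((u₀ , u₁) , (v₀ , v₁)) (inj₂ (v≤ , ≤u)) =
  half-≤ (≤-trans v₀ v≤) , *-cancelˡ-≤ 2 (≤-trans ≤u u₁)

LocalEdge : Pt × Pt → Set
LocalEdge ((a , _) , (b , _)) = a ≤ 2 × b ≤ 2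

shift-strip : ∀ j e → LocalEdge e → InStrip j (shiftE (2 * j) e)
shift-strip j ((a , _) , (b , _)) (a≤2 , b≤2) = (m≤m+n (2 * j) a , within a≤2) , (m≤m+n (2 * j) b , within b≤2)
  where
  within : ∀ {a} → a ≤ 2 → 2 * j + a ≤ 2 * suc j
  within a≤2 = ≤-trans (+-monoʳ-≤ (2 * j) a≤2) (≤-reflexive (trans (+-comm (2 * j) 2) (sym (*-suc 2 j))))

joinE : Pair → Pair → List (Pt × Pt)
joinE P Q = ((1 , aOf P) , (2 , bOf Q)) ∷ ((1 , 5 ∸ aOf P) , (2 , 5 ∸ bOf Q)) ∷ []

segments : ℕ → List Pair → List (List (Pt × Pt))
segments j [] = []
segments j (P ∷ []) = map (shiftE (2 * j)) (blockE P) ∷ []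
segments j (P ∷ Q ∷ Ps) = map (shiftE (2 * j)) (blockE P ++ joinE P Q) ∷ segments (suc j) (Q ∷ Ps)

edges-segments : ∀ j Ps → edgesFrom j Ps ≡ concat (segments j Ps)
edges-segments j [] = refl
edges-segments j (P ∷ []) = sym (++-identityʳ _)
edges-segments j (P ∷ Q ∷ Ps) = begin
  map shift (blockE P) ++ connect j P Q ++ edgesFrom (suc j) (Q ∷ Ps)
    ≡⟨ cong (λ es → map shift (blockE P) ++ connect j P Q ++ es) (edges-segments (suc j) (Q ∷ Ps)) ⟩
  map shift (blockE P) ++ map shift (joinE P Q) ++ rest
    ≡⟨ ++-assoc (map shift (blockE P)) (map shift (joinE P Q)) rest ⟨
  (map shift (blockE P) ++ map shift (joinE P Q)) ++ rest
    ≡⟨ cong (_++ rest) (map-++ shift (blockE P) (joinE P Q)) ⟨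
  map shift (blockE P ++ joinE P Q) ++ rest
    ∎
  where
  open ≡-Reasoning
  shift : Pt × Pt → Pt × Pt
  shift = shiftE (2 * j)
  rest : List (Pt × Pt)
  rest = concat (segments (suc j) (Q ∷ Ps))

blockE-local : ∀ P → All LocalEdge (blockE P) × length (blockE P) ≤ 4
blockE-local P = toWitness {a? = local? P} (check P)
  where
  localEdge? : ∀ e → Dec (LocalEdge e)
  localEdge? ((a , _) , (b , _)) = (a ≤? 2) ×-dec (b ≤? 2)
  local? : ∀ P → Dec (All LocalEdge (blockE P) × length (blockE P) ≤ 4)
  local? P = allᴸ? localEdge? (blockE P) ×-dec (length (blockE P) ≤? 4)
  check : ∀ P → True (local? P)
  check (false , false) = _
  check (false , true) = _
  check (true , false) = _
  check (true , true) = _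

joinE-local : ∀ P Q → All LocalEdge (joinE P Q)
joinE-local P Q = two ∷ two ∷ []
  where
  two : 1 ≤ 2 × 2 ≤ 2
  two = s≤s z≤n , ≤-refl

-- Only segments j with j ≤ B ≤ j + 1 can contain edges crossing the gap in block B,
-- so the numbers of crossing edges per segment form a window around B.
module CrossingCount (B : ℕ) (p : Pt × Pt → Bool) (crossing : ∀ e → T (p e) → Crossing B e) where

  segment-window : ∀ j S {cs} → All LocalEdge S → length S ≤ 6 → Window B (suc j) cs →
    Window B j (count p (map (shiftE (2 * j)) S) ∷ cs)
  segment-window j S {cs} local size rest with (j ≤? B) ×-dec (B ≤? suc j)
  ... | yes (j≤B , B≤1+j) =
    inside j≤B B≤1+j (≤-trans (length-filter (T? ∘ p) (map (shiftE (2 * j)) S)) (subst (_≤ 6) (sym (length-map _ S)) size)) rest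
  ... | no off = subst (λ c → Window B j (c ∷ cs)) (sym none) (outside rest)
    where
    uncrossed : ∀ {e} → LocalEdge e → ¬ T (p (shiftE (2 * j) e))
    uncrossed {e} l t = off (strip-crossing (shiftE (2 * j) e) (shift-strip j e l) (crossing _ t))
    none : count p (map (shiftE (2 * j)) S) ≡ 0
    none = cong length (filter-none (T? ∘ p) (map⁺ (mapAll uncrossed local)))

  segments-window : ∀ j Ps → Window B j (map (count p) (segments j Ps))
  segments-window j [] = []
  segments-window j (P ∷ []) =
    segment-window j (blockE P) (proj₁ (blockE-local P)) (≤-trans (proj₂ (blockE-local P)) (m≤m+n 4 2)) []
  segments-window j (P ∷ Q ∷ Ps) =
    segment-window j (blockE P ++ joinE P Q) (++⁺ (proj₁ (blockE-local P)) (joinE-local P Q))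
      (subst (_≤ 6) (sym (length-++ (blockE P))) (+-monoˡ-≤ 2 (proj₂ (blockE-local P))))
      (segments-window (suc j) (Q ∷ Ps))

  crossing-count : ∀ Ps → count p (edgesFrom 0 Ps) ≤ 12
  crossing-count Ps =
    subst (_≤ 12) (sym (trans (cong (count p) (edges-segments 0 Ps)) (count-concat p (segments 0 Ps))))
          (window-sum (segments-window 0 Ps))

module Gaps {N : ℕ} (A : Fin N → Pt → Bool) (v : Fin N → Pt) (only : ∀ i w → A i w ≡ true → w ≡ v i)
            (v-col : ∀ i → 2 * (toℕ i / 6) ≤ col (v i) × col (v i) ≤ suc (2 * (toℕ i / 6)))
            (g : Fin N) where

  B : ℕ
  B = toℕ g / 6

  before-col : ∀ u → T (before A g u) → col u ≤ suc (2 * B)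
  before-col u t
    with i , hit ← satisfied (any⁻ _ (allFin N) t)
    with i≤g , Aiu ← to T-∧ hit =
    subst (λ w → col w ≤ suc (2 * B)) (sym (only i u (to T-≡ Aiu)))
          (≤-trans (proj₂ (v-col i)) (s≤s (*-monoʳ-≤ 2 (/-monoˡ-≤ 6 (≤ᵇ⇒≤ (toℕ i) (toℕ g) i≤g)))))

  after-col : ∀ u → T (after A g u) → 2 * B ≤ col u
  after-col u t
    with i , hit ← satisfied (any⁻ _ (allFin N) t)
    with g<i , Aiu ← to T-∧ hit =
    subst (λ w → 2 * B ≤ col w) (sym (only i u (to T-≡ Aiu)))
          (≤-trans (*-monoʳ-≤ 2 (/-monoˡ-≤ 6 (<⇒≤ (<ᵇ⇒< (toℕ g) (toℕ i) g<i)))) (proj₁ (v-col i)))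

  crossing : ∀ e → T ((before A g (proj₁ e) ∧ after A g (proj₂ e)) ∨
                       (before A g (proj₂ e) ∧ after A g (proj₁ e))) → Crossing B e
  crossing (u , w) t with to T-∨ t
  ... | inj₁ t' = let (bu , aw) = to T-∧ t' in inj₁ (before-col u bu , after-col w aw)
  ... | inj₂ t' = let (bw , au) = to T-∧ t' in inj₂ (before-col w bw , after-col u au)

cutwidth-≤ : ∀ (Γ : Graph) {N} (A : Fin N → Pt → Bool) {k} → (∀ g → cut Γ A g ≤ k) → cutwidth Γ A ≤ k
cutwidth-≤ Γ {N} A {k} cut≤ = maximum≤ (allFin N)
  where
  maximum≤ : ∀ gs → foldr _⊔_ 0 (map (cut Γ A) gs) ≤ k
  maximum≤ [] = z≤n
  maximum≤ (g ∷ gs) = ⊔-lub (cut≤ g) (maximum≤ gs)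

module OnInput {n : ℕ} (x : Vec Bool n) where

  vertexAt : Fin (numPos n) → Pt
  vertexAt i = vert x (toℕ i)

  arrangement : Fin (numPos n) → Pt → Bool
  arrangement = computed arrangementCircuits x

  open PointTests arrangementCircuits x vertexAt (arrangementCircuits-test x)

  linear : IsLinearArrangement (G (toList x)) (numPos n) arrangement
  linear = bijection-arrangement (G (toList x)) arrangement vertexAt computed-only
    (λ i → let (c< , r<) = vert-grid x (toℕ<n i) in computed-hit i c< r<)
    (λ e → toℕ-injective (vert-injective x e))
    (λ i → vert-∈ x (toℕ<n i))
    (λ w w∈ → let (i , i< , vi≡w) = vert-onto x w∈ in fromℕ< i< , trans (cong (vert x) (toℕ-fromℕ< i<)) vi≡w)

  -- Every cut meets at most the two segments around its block.
  narrow : cutwidth (G (toList x)) arrangement ≤ 12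
  narrow = cutwidth-≤ (G (toList x)) arrangement λ g →
    CrossingCount.crossing-count (toℕ g / 6) _ (Gaps.crossing arrangement vertexAt computed-only vertexAt-col g) (pairSeq x)
    where
    vertexAt-col : ∀ i → 2 * (toℕ i / 6) ≤ col (vertexAt i) × col (vertexAt i) ≤ suc (2 * (toℕ i / 6))
    vertexAt-col i = place-col (blockOf (toℕ i)) (pairAt x (blockOf (toℕ i))) (slotOf (toℕ i))

lemma19 : ∃[ k ] ∃[ d ] ∃[ c ] Σ[ C ∈ OutputFamily ]
              (((n : ℕ) (i : Fin (numPos n)) (col : Fin (numCols n)) (row : Fin 6) →
                  depth (C n i col row) ≤ d × size (C n i col row) ≤ c * n ^ c + c)
              × ((n : ℕ) (x : Vec Bool n) →
                  IsLinearArrangement (G (toList x)) (numPos n) (computed C x)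
                  × cutwidth (G (toList x)) (computed C x) ≤ k))
lemma19 = 12 , 1 , 2 , arrangementCircuits , small , λ n x → OnInput.linear x , OnInput.narrow x
  where
  small : ∀ n i c r → depth (arrangementCircuits n i c r) ≤ 1 × size (arrangementCircuits n i c r) ≤ 2 * n ^ 2 + 2
  small n i c r with d≤1 , s≤2 ← arrangementCircuits-shallow n i c r = d≤1 , ≤-trans s≤2 (m≤n+m 2 (2 * n ^ 2))
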